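{- Let $G$ and $G'$ be graphs. If $F$ is a fort of $G$ and $F'$ is a fort of $G'$, then $F\times F'$ is a fort of $G\Box G'$. Furthermore, $\tau(\mathcal F_G\times\mathcal F_{G'})\le \operatorname{Z}(G\Box G')$.
   Context: All graphs are finite, simple and undirected with nonempty vertex sets. Zero forcing: given $B\subseteq V(G)$ initially filled, a filled vertex $u$ may force an unfilled vertex $w$ if $w$ is the only unfilled neighbor of $u$; $B$ is a zero forcing set if repeated forcing fills all vertices; $\operatorname{Z}(G)$ is the minimum size of a zero forcing set. A fort of $G$ is a nonempty $F\subseteq V(G)$ such that every $v\in V(G)\setminus F$ has $|N_G(v)\cap F|\neq 1$; a minimal fort is one not properly containing another fort. A hypergraph $H$ consists of a finite vertex set $V(H)$ and a set $E(H)$ of nonempty subsets (edges) whose union is $V(H)$. The fort hypergraph $\mathcal F_G$ has as edges the minimal forts of $G$ and as vertex set their union. For hypergraphs $H_1,H_2$, $H_1\times H_2$ has vertex set $V(H_1)\times V(H_2)$ and edges $\{e_1\times e_2: e_1\in E(H_1), e_2\in E(H_2)\}$. $\tau(H)$ is the minimum size of a set of vertices meeting every edge of $H$. The Cartesian product $G\Box G'$ has vertex set $V(G)\times V(G')$, with $(u,u')\sim(v,v')$ iff ($u=v$ and $u'v'\in E(G')$) or ($u'=v'$ and $uv\in E(G)$). -}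

module Defs where

open import Data.Nat using (ℕ; zero; suc; _*_; _<_; _≤_)
open import Data.Nat.Properties using (*-monoˡ-<)
open import Data.Bool using (Bool; true; false; _∧_; _∨_; if_then_else_)
open import Data.Bool.Properties using (∨-comm)
open import Data.Fin using (Fin; remQuot; combine; _≟_)
open import Data.Fin.Subset using (Subset; _∈_; _∉_; _⊆_; _∩_; _∪_; ∣_∣; ⁅_⁆; ⊤; Nonempty)
open import Data.Vec using (tabulate)
open import Data.Product using (Σ; ∃; ∃-syntax; _×_; _,_; proj₁; proj₂)
open import Relation.Nullary using (¬_; does)
open import Relation.Binary.PropositionalEquality using (_≡_; _≢_; refl; sym; cong₂)
open import Relation.Binary.Construct.Closure.ReflexiveTransitive using (Star)

record Graph : Set where
  field
    n        : ℕ
    nonempty : 0 < n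
    adj      : Fin n → Fin n → Bool
    adj-sym  : ∀ u v → adj u v ≡ adj v u
    adj-irr  : ∀ v → adj v v ≡ false

open Graph public

_==_ : ∀ {k} → Fin k → Fin k → Bool
u == v = does (u ≟ v)

==-sym : ∀ {k} (u v : Fin k) → (u == v) ≡ (v == u)
==-sym u v with u ≟ v | v ≟ u
... | Relation.Nullary.yes _ | Relation.Nullary.yes _ = refl
... | Relation.Nullary.no _  | Relation.Nullary.no _  = refl
... | Relation.Nullary.yes p | Relation.Nullary.no q  = Data.Empty.⊥-elim (q (sym p))
  where import Data.Empty
... | Relation.Nullary.no p  | Relation.Nullary.yes q = Data.Empty.⊥-elim (p (sym q))
  where import Data.Empty

==-refl : ∀ {k} (u : Fin k) → (u == u) ≡ true
==-refl u with u ≟ u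
... | Relation.Nullary.yes _ = refl
... | Relation.Nullary.no p  = Data.Empty.⊥-elim (p refl)
  where import Data.Empty

N : (G : Graph) → Fin (n G) → Subset (n G)
N G v = tabulate (adj G v)

IsFort : (G : Graph) → Subset (n G) → Set
IsFort G F = Nonempty F × (∀ v → v ∉ F → ∣ N G v ∩ F ∣ ≢ 1)

IsMinimalFort : (G : Graph) → Subset (n G) → Set
IsMinimalFort G F = IsFort G F × (∀ F′ → IsFort G F′ → F′ ⊆ F → F ⊆ F′)

-- Vertex set of the fort hypergraph 𝓕_G: the union of the minimal forts
InFortHypergraph : (G : Graph) → Fin (n G) → Set
InFortHypergraph G v = ∃[ F ] (IsMinimalFort G F × v ∈ F)

-- Cartesian product G □ G' on Fin (n G * n G'); the vertex (u , u') is
-- encoded as combine u u' (with inverse remQuot).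
private
  padjP : (G G′ : Graph) → Fin (n G) × Fin (n G′) → Fin (n G) × Fin (n G′) → Bool
  padjP G G′ (u , u′) (v , v′) = ((u == v) ∧ adj G′ u′ v′) ∨ ((u′ == v′) ∧ adj G u v)

  padj : (G G′ : Graph) → Fin (n G * n G′) → Fin (n G * n G′) → Bool
  padj G G′ i j = padjP G G′ (remQuot (n G′) i) (remQuot (n G′) j)

  padjP-sym : ∀ G G′ p q → padjP G G′ p q ≡ padjP G G′ q p
  padjP-sym G G′ (u , u′) (v , v′) =
    cong₂ _∨_ (cong₂ _∧_ (==-sym u v) (adj-sym G′ u′ v′))
              (cong₂ _∧_ (==-sym u′ v′) (adj-sym G u v))

  padj-sym : ∀ G G′ i j → padj G G′ i j ≡ padj G G′ j i
  padj-sym G G′ i j = padjP-sym G G′ (remQuot (n G′) i) (remQuot (n G′) j)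

  padjP-irr : ∀ G G′ p → padjP G G′ p p ≡ false
  padjP-irr G G′ (u , u′) rewrite ==-refl u | ==-refl u′ | adj-irr G′ u′ | adj-irr G u = refl

  padj-irr : ∀ G G′ i → padj G G′ i i ≡ false
  padj-irr G G′ i = padjP-irr G G′ (remQuot (n G′) i)

  pos : ∀ {a b} → 0 < a → 0 < b → 0 < a * b
  pos {suc a} {suc b} _ _ = Data.Nat.s≤s Data.Nat.z≤n

_□_ : Graph → Graph → Graph
G □ G′ = record
  { n        = n G * n G′
  ; nonempty = pos (nonempty G) (nonempty G′)
  ; adj      = padj G G′
  ; adj-sym  = padj-sym G G′
  ; adj-irr  = padj-irr G G′
  }

_⊠_ : ∀ {a b} → Subset a → Subset b → Subset (a * b)
_⊠_ {a} {b} F F′ = tabulate λ i → Data.Vec.lookup F (proj₁ (remQuot {a} b i)) ∧ Data.Vec.lookup F′ (proj₂ (remQuot {a} b i))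

data Force (G : Graph) (S : Subset (n G)) : Subset (n G) → Set where
  force : ∀ u w → u ∈ S → w ∉ S → w ∈ N G u →
          (∀ x → x ∈ N G u → x ∉ S → x ≡ w) →
          Force G S (S ∪ ⁅ w ⁆)

IsZeroForcingSet : (G : Graph) → Subset (n G) → Set
IsZeroForcingSet G B = Star (Force G) B ⊤

IsFortProductTransversal : (G G′ : Graph) → Subset (n G * n G′) → Set
IsFortProductTransversal G G′ T =
  (∀ u u′ → combine u u′ ∈ T → InFortHypergraph G u × InFortHypergraph G′ u′)
  × (∀ F F′ → IsMinimalFort G F → IsMinimalFort G′ F′ →
       ∃[ u ] ∃[ u′ ] (u ∈ F × u′ ∈ F′ × combine u u′ ∈ T))

-- A vertex outside F × F′ that is adjacent to (b , b′) ∈ F × F′ shares a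
-- coordinate with it, say (b , u′) with u′ ∉ F′; the neighbours of u′ in F′
-- embed into its neighbours in F × F′ along the row b, so a unique neighbour in
-- F × F′ would give u′ a unique neighbour in F′.  A forcing step never fills a
-- vertex of a fort disjoint from the filled set, so every zero forcing set meets
-- every fort, in particular every F × F′ with F, F′ minimal forts; the points of
-- B lying in V(𝓕_G) × V(𝓕_G′) therefore form a transversal no larger than B.
module Submission where

open import Defs
open import Data.Nat using (_≤_)
open import Data.Fin.Subset using (∣_∣)
open import Data.Product using (_×_; ∃-syntax)

open import Data.Nat.Base using (ℕ; _*_)
import Data.Nat.Properties as ℕ
open import Data.Bool.Base using (Bool; T; _∧_; _∨_)
open import Data.Bool.Properties using (T-≡; T-∧; T-∨)
open import Data.Fin.Base using (Fin; zero; suc; combine; remQuot)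
open import Data.Fin.Properties
  using (_≟_; all?; remQuot-combine; combine-remQuot; combine-injectiveʳ; combine-injectiveˡ)
open import Data.Fin.Subset using (Subset; inside; outside; _∈_; _∉_; _∩_; ⁅_⁆; ⊥; Nonempty; Empty)
open import Data.Fin.Subset.Properties
  using (_∈?_; _⊆?_; nonempty?; anySubset?; ⊆-antisym; x∈⁅x⁆; x∈⁅y⁆⇒x≡y; ∣⁅x⁆∣≡1; ∈⊤;
         x∈p∩q⁺; x∈p∩q⁻; p∩q⊆p; x∈p∪q⁻; p⊆q⇒∣p∣≤∣q∣)
open import Data.Vec.Base using (lookup; tabulate; _∷_; [])
open import Data.Vec.Properties using ([]=⇒lookup; lookup⇒[]=; lookup∘tabulate)
open import Data.Product using (_,_; proj₁; proj₂; uncurry)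
open import Data.Sum using (inj₁; inj₂; _⊎_)
open import Function.Base using (id; _∘_)
open import Function.Bundles using (Equivalence)
open import Level using (Level)
open import Relation.Nullary using (Dec; yes; no; isYes; contradiction)
open import Relation.Nullary.Decidable
  using (_×-dec_; _→-dec_; ¬?; decidable-stable; toWitness; fromWitness)
open import Relation.Unary using (Pred; Decidable)
open import Relation.Binary.PropositionalEquality
  using (_≡_; _≢_; refl; sym; trans; cong; cong₂; subst)
open import Relation.Binary.Construct.Closure.ReflexiveTransitive using (Star; ε; _◅_)

open Equivalence using (to; from)

private
  variable
    ℓ : Level
    k m : ℕ
    x : Fin k
    p q : Subset k

∈⇒T-lookup : x ∈ p → T (lookup p x)
∈⇒T-lookup x∈p = from T-≡ ([]=⇒lookup x∈p)

T-lookup⇒∈ : T (lookup p x) → x ∈ p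
T-lookup⇒∈ {p = p} {x = x} t = lookup⇒[]= x p (to T-≡ t)

∈-tabulate⁺ : ∀ {f : Fin k → Bool} {x} → T (f x) → x ∈ tabulate f
∈-tabulate⁺ {f = f} {x} t = T-lookup⇒∈ (subst T (sym (lookup∘tabulate f x)) t)

∈-tabulate⁻ : ∀ {f : Fin k → Bool} {x} → x ∈ tabulate f → T (f x)
∈-tabulate⁻ {f = f} {x} x∈ = subst T (lookup∘tabulate f x) (∈⇒T-lookup x∈)

T-==⇒≡ : {u v : Fin k} → T (u == v) → u ≡ v
T-==⇒≡ {u = u} {v} t with u ≟ v | t
... | yes u≡v | _ = u≡v

∣p∣≡0⇒p≡⊥ : (p : Subset k) → ∣ p ∣ ≡ 0 → p ≡ ⊥
∣p∣≡0⇒p≡⊥ []            _     = refl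
∣p∣≡0⇒p≡⊥ (outside ∷ p) ∣p∣≡0 = cong (outside ∷_) (∣p∣≡0⇒p≡⊥ p ∣p∣≡0)

∣p∣≡1⇒p≡⁅x⁆ : (p : Subset k) → ∣ p ∣ ≡ 1 → ∃[ x ] p ≡ ⁅ x ⁆
∣p∣≡1⇒p≡⁅x⁆ (inside ∷ p)  ∣p∣≡1 = zero , cong (inside ∷_) (∣p∣≡0⇒p≡⊥ p (ℕ.suc-injective ∣p∣≡1))
∣p∣≡1⇒p≡⁅x⁆ (outside ∷ p) ∣p∣≡1 with ∣p∣≡1⇒p≡⁅x⁆ p ∣p∣≡1
... | x , p≡⁅x⁆ = suc x , cong (outside ∷_) p≡⁅x⁆

p⊆⁅x⁆⇒p≡⁅x⁆ : x ∈ p → (∀ {y} → y ∈ p → y ≡ x) → p ≡ ⁅ x ⁆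
p⊆⁅x⁆⇒p≡⁅x⁆ {x = x} {p = p} x∈p unique =
  ⊆-antisym (λ y∈p → subst (_∈ ⁅ x ⁆) (sym (unique y∈p)) (x∈⁅x⁆ x))
            (λ y∈⁅x⁆ → subst (_∈ p) (sym (x∈⁅y⁆⇒x≡y x y∈⁅x⁆)) x∈p)

injection-reflects-singleton : {g : Fin m → Fin k} {p : Subset m} →
  (∀ {x y} → g x ≡ g y → x ≡ y) → (∀ {y} → y ∈ p → g y ∈ q) →
  q ≡ ⁅ g x ⁆ → x ∈ p → p ≡ ⁅ x ⁆
injection-reflects-singleton {q = q} {x = x} {g = g} injective maps q≡⁅gx⁆ x∈p =
  p⊆⁅x⁆⇒p≡⁅x⁆ x∈p (λ {y} y∈p →
    injective (x∈⁅y⁆⇒x≡y (g x) (subst (g y ∈_) q≡⁅gx⁆ (maps y∈p))))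

allSubset? : {P : Pred (Subset k) ℓ} → Decidable P → Dec (∀ p → P p)
allSubset? P? with anySubset? (¬? ∘ P?)
... | yes (p , ¬Pp) = no λ ∀P → ¬Pp (∀P p)
... | no ∄¬P        = yes λ p → decidable-stable (P? p) (λ ¬Pp → ∄¬P (p , ¬Pp))

data CombineView (a b : ℕ) : Fin (a * b) → Set where
  combined : (u : Fin a) (u′ : Fin b) → CombineView a b (combine u u′)

combineView : ∀ a b (i : Fin (a * b)) → CombineView a b i
combineView a b i =
  subst (CombineView a b) (combine-remQuot {a} b i) (uncurry combined (remQuot {a} b i))

lookup-⊠ : ∀ {a b} (F : Subset a) (F′ : Subset b) u u′ →
           lookup (F ⊠ F′) (combine u u′) ≡ lookup F u ∧ lookup F′ u′
lookup-⊠ {b = b} F F′ u u′ =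
  trans (lookup∘tabulate _ (combine u u′))
        (cong (λ r → lookup F (proj₁ r) ∧ lookup F′ (proj₂ r)) (remQuot-combine {k = b} u u′))

∈-⊠⁺ : ∀ {a b} {F : Subset a} {F′ : Subset b} {u u′} →
       u ∈ F → u′ ∈ F′ → combine u u′ ∈ F ⊠ F′
∈-⊠⁺ {F = F} {F′} {u} {u′} u∈F u′∈F′ =
  T-lookup⇒∈ (subst T (sym (lookup-⊠ F F′ u u′)) (from T-∧ (∈⇒T-lookup u∈F , ∈⇒T-lookup u′∈F′)))

∈-⊠⁻ : ∀ {a b} {F : Subset a} {F′ : Subset b} {u u′} →
       combine u u′ ∈ F ⊠ F′ → u ∈ F × u′ ∈ F′
∈-⊠⁻ {F = F} {F′} {u} {u′} uu′∈ with to T-∧ (subst T (lookup-⊠ F F′ u u′) (∈⇒T-lookup uu′∈))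
... | Fu , F′u′ = T-lookup⇒∈ Fu , T-lookup⇒∈ F′u′

fort-nonsingleton : ∀ G {F v x} → IsFort G F → v ∉ F → N G v ∩ F ≢ ⁅ x ⁆
fort-nonsingleton _ {x = x} (_ , fortF) v∉F N∩F≡⁅x⁆ =
  fortF _ v∉F (trans (cong ∣_∣ N∩F≡⁅x⁆) (∣⁅x⁆∣≡1 x))

module _ {G : Graph} {F : Subset (n G)} (isFort : IsFort G F) where

  force-avoids-fort : ∀ {S S′} → Force G S S′ → Empty (F ∩ S) → Empty (F ∩ S′)
  force-avoids-fort {S} (force u w u∈S w∉S w∈Nu onlyUnfilled) F∩S=∅ (x , x∈F∩S′)
    with x∈p∩q⁻ F _ x∈F∩S′
  ... | x∈F , x∈S′ with x∈p∪q⁻ S ⁅ w ⁆ x∈S′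
  ... | inj₁ x∈S   = F∩S=∅ (x , x∈p∩q⁺ (x∈F , x∈S))
  ... | inj₂ x∈⁅w⁆ =
    fort-nonsingleton G isFort (λ u∈F → avoids-S u∈F u∈S)
      (p⊆⁅x⁆⇒p≡⁅x⁆ (x∈p∩q⁺ (w∈Nu , w∈F)) onlyUnfilled-in-F)
    where
    avoids-S : ∀ {y} → y ∈ F → y ∉ S
    avoids-S y∈F y∈S = F∩S=∅ (_ , x∈p∩q⁺ (y∈F , y∈S))
    w∈F : w ∈ F
    w∈F = subst (_∈ F) (x∈⁅y⁆⇒x≡y w x∈⁅w⁆) x∈F
    onlyUnfilled-in-F : ∀ {y} → y ∈ N G u ∩ F → y ≡ w
    onlyUnfilled-in-F y∈N∩F =
      let y∈N , y∈F = x∈p∩q⁻ _ _ y∈N∩F in onlyUnfilled _ y∈N (avoids-S y∈F)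

  forcing-avoids-fort : ∀ {S S′} → Star (Force G) S S′ → Empty (F ∩ S) → Empty (F ∩ S′)
  forcing-avoids-fort ε              = id
  forcing-avoids-fort (step ◅ steps) = forcing-avoids-fort steps ∘ force-avoids-fort step

  zeroForcingSet-meets-fort : ∀ {B} → IsZeroForcingSet G B → Nonempty (F ∩ B)
  zeroForcingSet-meets-fort {B} forcing with nonempty? (F ∩ B)
  ... | yes F∩B≠∅ = F∩B≠∅
  ... | no  F∩B=∅ = let a , a∈F = proj₁ isFort in
    contradiction (a , x∈p∩q⁺ (a∈F , ∈⊤)) (forcing-avoids-fort forcing F∩B=∅)

isFort? : (G : Graph) → Decidable (IsFort G)
isFort? G F = nonempty? F ×-dec all? (λ v → ¬? (v ∈? F) →-dec ¬? (∣ N G v ∩ F ∣ ℕ.≟ 1))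

isMinimalFort? : (G : Graph) → Decidable (IsMinimalFort G)
isMinimalFort? G F =
  isFort? G F ×-dec allSubset? (λ F′ → isFort? G F′ →-dec (F′ ⊆? F →-dec F ⊆? F′))

inFortHypergraph? : (G : Graph) → Decidable (InFortHypergraph G)
inFortHypergraph? G v = anySubset? (λ F → isMinimalFort? G F ×-dec v ∈? F)

fortHypergraphVertices : (G : Graph) → Subset (n G)
fortHypergraphVertices G = tabulate (isYes ∘ inFortHypergraph? G)

∈-fortHypergraphVertices⁺ : ∀ G {v} → InFortHypergraph G v → v ∈ fortHypergraphVertices G
∈-fortHypergraphVertices⁺ G = ∈-tabulate⁺ ∘ fromWitness

∈-fortHypergraphVertices⁻ : ∀ G {v} → v ∈ fortHypergraphVertices G → InFortHypergraph G v
∈-fortHypergraphVertices⁻ G = toWitness ∘ ∈-tabulate⁻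

module _ (G G′ : Graph) where

  adj-□ : ∀ u u′ x x′ → adj (G □ G′) (combine u u′) (combine x x′)
                        ≡ ((u == x) ∧ adj G′ u′ x′) ∨ ((u′ == x′) ∧ adj G u x)
  adj-□ u u′ x x′ =
    cong₂ (λ r s → ((proj₁ r == proj₁ s) ∧ adj G′ (proj₂ r) (proj₂ s))
                   ∨ ((proj₂ r == proj₂ s) ∧ adj G (proj₁ r) (proj₁ s)))
          (remQuot-combine {k = n G′} u u′) (remQuot-combine {k = n G′} x x′)

  ∈-N□⁻ : ∀ {u u′ x x′} → combine x x′ ∈ N (G □ G′) (combine u u′) →
          (u ≡ x × x′ ∈ N G′ u′) ⊎ (u′ ≡ x′ × x ∈ N G u)
  ∈-N□⁻ {u} {u′} {x} {x′} xx′∈N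
    with to (T-∨ {(u == x) ∧ adj G′ u′ x′}) (subst T (adj-□ u u′ x x′) (∈-tabulate⁻ xx′∈N))
  ... | inj₁ row    = let u≡x , u′~x′ = to T-∧ row in inj₁ (T-==⇒≡ u≡x , ∈-tabulate⁺ u′~x′)
  ... | inj₂ column = let u′≡x′ , u~x = to T-∧ column in inj₂ (T-==⇒≡ u′≡x′ , ∈-tabulate⁺ u~x)

  ∈-N□ʳ⁺ : ∀ {u u′ x′} → x′ ∈ N G′ u′ → combine u x′ ∈ N (G □ G′) (combine u u′)
  ∈-N□ʳ⁺ {u} {u′} {x′} x′∈N = ∈-tabulate⁺ (subst T (sym (adj-□ u u′ u x′))
    (from (T-∨ {(u == u) ∧ adj G′ u′ x′})
          (inj₁ (from T-∧ (from T-≡ (==-refl u) , ∈-tabulate⁻ x′∈N)))))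

  ∈-N□ˡ⁺ : ∀ {u u′ x} → x ∈ N G u → combine x u′ ∈ N (G □ G′) (combine u u′)
  ∈-N□ˡ⁺ {u} {u′} {x} x∈N = ∈-tabulate⁺ (subst T (sym (adj-□ u u′ x u′))
    (from (T-∨ {(u == x) ∧ adj G′ u′ u′})
          (inj₂ (from T-∧ (from T-≡ (==-refl u′) , ∈-tabulate⁻ x∈N)))))

  row-slice : ∀ {F : Subset (n G)} {F′ : Subset (n G′)} {u u′ x′} → u ∈ F → x′ ∈ N G′ u′ ∩ F′ →
              combine u x′ ∈ N (G □ G′) (combine u u′) ∩ (F ⊠ F′)
  row-slice u∈F x′∈N∩F′ = let x′∈N , x′∈F′ = x∈p∩q⁻ _ _ x′∈N∩F′ in
    x∈p∩q⁺ (∈-N□ʳ⁺ x′∈N , ∈-⊠⁺ u∈F x′∈F′)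

  column-slice : ∀ {F : Subset (n G)} {F′ : Subset (n G′)} {u u′ x} → u′ ∈ F′ → x ∈ N G u ∩ F →
                 combine x u′ ∈ N (G □ G′) (combine u u′) ∩ (F ⊠ F′)
  column-slice u′∈F′ x∈N∩F = let x∈N , x∈F = x∈p∩q⁻ _ _ x∈N∩F in
    x∈p∩q⁺ (∈-N□ˡ⁺ x∈N , ∈-⊠⁺ x∈F u′∈F′)

  ⊠-isFort : ∀ {F : Subset (n G)} {F′ : Subset (n G′)} →
             IsFort G F → IsFort G′ F′ → IsFort (G □ G′) (F ⊠ F′)
  ⊠-isFort {F} {F′} isFortF@((a , a∈F) , _) isFortF′@((a′ , a′∈F′) , _) =
    (combine a a′ , ∈-⊠⁺ a∈F a′∈F′) , λ v v∉ ∣N∩⊠∣≡1 →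
      let j , N∩⊠≡⁅j⁆ = ∣p∣≡1⇒p≡⁅x⁆ _ ∣N∩⊠∣≡1 in
      no-single-neighbour (combineView _ _ v) (combineView _ _ j) v∉ N∩⊠≡⁅j⁆
    where
    no-single-neighbour : ∀ {v j} → CombineView (n G) (n G′) v → CombineView (n G) (n G′) j →
                          v ∉ F ⊠ F′ → N (G □ G′) v ∩ (F ⊠ F′) ≢ ⁅ j ⁆
    no-single-neighbour (combined u u′) (combined b b′) v∉ N∩⊠≡⁅j⁆
      with x∈p∩q⁻ _ _ (subst (combine b b′ ∈_) (sym N∩⊠≡⁅j⁆) (x∈⁅x⁆ _))
    ... | j∈N , j∈⊠ with ∈-N□⁻ j∈N | ∈-⊠⁻ j∈⊠
    ... | inj₁ (refl , b′∈N) | u∈F , b′∈F′ =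
      fort-nonsingleton G′ isFortF′ (λ u′∈F′ → v∉ (∈-⊠⁺ u∈F u′∈F′))
        (injection-reflects-singleton (λ {x′} {y′} → combine-injectiveʳ u x′ u y′) (row-slice u∈F)
                                      N∩⊠≡⁅j⁆ (x∈p∩q⁺ (b′∈N , b′∈F′)))
    ... | inj₂ (refl , b∈N) | b∈F , u′∈F′ =
      fort-nonsingleton G isFortF (λ u∈F → v∉ (∈-⊠⁺ u∈F u′∈F′))
        (injection-reflects-singleton (λ {x} {y} → combine-injectiveˡ x u′ y u′)
                                      (column-slice u′∈F′)
                                      N∩⊠≡⁅j⁆ (x∈p∩q⁺ (b∈N , b∈F)))

  fortProductVertices : Subset (n G * n G′)
  fortProductVertices = fortHypergraphVertices G ⊠ fortHypergraphVertices G′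

  zeroForcingSet⇒fortProductTransversal : ∀ {B} → IsZeroForcingSet (G □ G′) B →
    IsFortProductTransversal G G′ (B ∩ fortProductVertices)
  zeroForcingSet⇒fortProductTransversal {B} forcing = inVertices , meetsEdges
    where
    inVertices : ∀ u u′ → combine u u′ ∈ B ∩ fortProductVertices →
                 InFortHypergraph G u × InFortHypergraph G′ u′
    inVertices u u′ uu′∈ = let u∈V , u′∈V′ = ∈-⊠⁻ (proj₂ (x∈p∩q⁻ B _ uu′∈)) in
      ∈-fortHypergraphVertices⁻ G u∈V , ∈-fortHypergraphVertices⁻ G′ u′∈V′

    meetsEdges : ∀ F F′ → IsMinimalFort G F → IsMinimalFort G′ F′ →
                 ∃[ u ] ∃[ u′ ] (u ∈ F × u′ ∈ F′ × combine u u′ ∈ B ∩ fortProductVertices)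
    meetsEdges F F′ minF minF′ =
      let i , i∈ = zeroForcingSet-meets-fort (⊠-isFort (proj₁ minF) (proj₁ minF′)) forcing in
      hit (combineView _ _ i) i∈
      where
      hit : ∀ {i} → CombineView (n G) (n G′) i → i ∈ (F ⊠ F′) ∩ B →
            ∃[ u ] ∃[ u′ ] (u ∈ F × u′ ∈ F′ × combine u u′ ∈ B ∩ fortProductVertices)
      hit (combined u u′) uu′∈ with x∈p∩q⁻ _ B uu′∈
      ... | uu′∈⊠ , uu′∈B with ∈-⊠⁻ uu′∈⊠
      ... | u∈F , u′∈F′ = u , u′ , u∈F , u′∈F′ , x∈p∩q⁺ (uu′∈B ,
        ∈-⊠⁺ (∈-fortHypergraphVertices⁺ G (F , minF , u∈F))
             (∈-fortHypergraphVertices⁺ G′ (F′ , minF′ , u′∈F′)))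

proposition4p1 :
    (∀ (G G′ : Graph) F F′ → IsFort G F → IsFort G′ F′ → IsFort (G □ G′) (F ⊠ F′))
    × (∀ (G G′ : Graph) B → IsZeroForcingSet (G □ G′) B →
         ∃[ T ] (IsFortProductTransversal G G′ T × ∣ T ∣ ≤ ∣ B ∣))
proposition4p1 =
  (λ G G′ _ _ → ⊠-isFort G G′) ,
  λ G G′ B forcing → B ∩ fortProductVertices G G′ ,
    zeroForcingSet⇒fortProductTransversal G G′ forcing ,
    p⊆q⇒∣p∣≤∣q∣ (p∩q⊆p B _)
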